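{- Let $B=(G,S,C,f_0)$ be a minimal counterexample, and let $T$ be a triangle in $G$ that has at least two vertices of degree three not belonging to $S$. Then all the edges of $T$ are full in the assignment $C$.
   Context: All graphs are finite and simple; $[3]=\{1,2,3\}$. For a graph $G$ with a fixed orientation, a $3$-correspondence assignment is a function $C$ assigning to each directed edge $uv$ an injective, not necessarily total, function $C_{uv}:[3]\to[3]$; set $C_{vu}=C_{uv}^{ -1}$. An edge $uv$ is full if $\mathrm{dom}(C_{uv})=[3]$. A $C$-coloring of $G$ (or of a subgraph, using the restriction of $C$) is $f:V(G)\to[3]$ such that for every directed edge $uv$, $f(u)\notin\mathrm{dom}(C_{uv})$ or $C_{uv}(f(u))\ne f(v)$. For a walk $W=v_1\dots v_m$, $C_W$ is the partial function obtained by applying successively $C_{v_1v_2},\dots,C_{v_{m-1}v_m}$ (defined where all steps are defined); a closed walk $W$ ($v_1=v_m$) has length $m-1$ and $C$ is consistent on it if $C_W(c)=c$ for all $c\in\mathrm{dom}(C_W)$. A target is a quadruple $B=(G,S,C,f_0)$ where $G$ is a plane graph without cycles of lengths $4$ to $8$; $S\subseteq V(G)$ consists either of at most one vertex incident with the outer face of $G$ or of all vertices incident with the outer face of $G$; $|S|\le 12$; $C$ is a $3$-correspondence assignment for $G$ consistent on every closed walk of length three in $G$; and $f_0$ is a $C$-coloring of $G[S]$. A target is a counterexample if no $C$-coloring of $G$ restricts to $f_0$ on $S$. Let $e(B)=|E(G)|-|E(G[S])|$ and $s(B)=(|V(G)|,\,e(B),\,-\sum_{uv\in E(G)}|\mathrm{dom}(C_{uv})|)$.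 A minimal counterexample is a counterexample $B$ with $s(B)$ lexicographically minimum among all counterexamples. -}

module Defs where

open import Data.Nat as ℕ using (ℕ; zero; suc; _≤_; _<_)
open import Data.Integer as ℤ using (ℤ)
open import Data.Fin as Fin using (Fin; toℕ; inject₁; fromℕ)
open import Data.Fin.Subset using (Subset; _∈_; _∉_; ∣_∣)
open import Data.Vec using (lookup)
open import Data.Bool using (Bool; true; false; if_then_else_; _∧_)
open import Data.Maybe using (Maybe; just; nothing; _>>=_; is-just)
open import Data.Rational as ℚ using (ℚ; 0ℚ; 1ℚ)
open import Data.Product using (Σ; _×_; _,_; proj₁)
open import Data.Product.Relation.Binary.Lex.Strict using (×-Lex)
open import Data.Sum using (_⊎_)
open import Data.Empty using (⊥)
open import Relation.Nullary using (¬_)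
open import Relation.Binary.PropositionalEquality using (_≡_; _≢_)

Point : Set
Point = ℚ × ℚ

OnSeg : Point → Point → Point → Set
OnSeg (x , y) (ax , ay) (bx , by) =
  Σ ℚ λ t → (0ℚ ℚ.≤ t) × (t ℚ.≤ 1ℚ) ×
            (x ≡ ax ℚ.+ t ℚ.* (bx ℚ.- ax)) × (y ≡ ay ℚ.+ t ℚ.* (by ℚ.- ay))

-- a polygonal curve with breakpoints pt 0, ..., pt len (len segments)
record Polyline : Set where
  field
    len : ℕ
    pt  : Fin (suc len) → Point

  start : Point
  start = pt Fin.zero

  end : Point
  end = pt (fromℕ len)

  OnSegment : Fin len → Point → Set
  OnSegment i q = OnSeg q (pt (inject₁ i)) (pt (Fin.suc i))

  On : Point → Set
  On q = Σ (Fin len) λ i → OnSegment i q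

  IsArc : Set
  IsArc = ∀ (i j : Fin len) → toℕ i < toℕ j →
    (suc (toℕ i) ≡ toℕ j → ∀ q → OnSegment i q → OnSegment j q → q ≡ pt (Fin.suc i)) ×
    (suc (toℕ i) < toℕ j → ∀ q → OnSegment i q → OnSegment j q → ⊥)

record Graph (n : ℕ) : Set where
  field
    adj    : Fin n → Subset n
    sym    : ∀ u v → v ∈ adj u → u ∈ adj v
    irrefl : ∀ v → v ∉ adj v

Adj : ∀ {n} → Graph n → Fin n → Fin n → Set
Adj G u v = v ∈ Graph.adj G u

adjB : ∀ {n} → Graph n → Fin n → Fin n → Bool
adjB G u v = lookup (Graph.adj G u) v

deg : ∀ {n} → Graph n → Fin n → ℕ
deg G v = ∣ Graph.adj G v ∣

HasCycle : ∀ {n} → Graph n → ℕ → Set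
HasCycle {n} G k = Σ (Fin k → Fin n) λ v →
  (∀ i j → v i ≡ v j → i ≡ j) ×
  (∀ i j → (suc (toℕ i) ≡ toℕ j ⊎ (suc (toℕ i) ≡ k × toℕ j ≡ 0)) → Adj G (v i) (v j))

sumFin : ∀ {n} → (Fin n → ℕ) → ℕ
sumFin {zero}  f = 0
sumFin {suc n} f = f Fin.zero ℕ.+ sumFin (λ i → f (Fin.suc i))

ind : Bool → ℕ
ind b = if b then 1 else 0

numEdges : ∀ {n} → Graph n → ℕ
numEdges G = sumFin λ u → sumFin λ v → ind (adjB G u v ∧ (toℕ u ℕ.<ᵇ toℕ v))

numEdgesIn : ∀ {n} → Graph n → Subset n → ℕ
numEdgesIn G S = sumFin λ u → sumFin λ v →
  ind (adjB G u v ∧ (toℕ u ℕ.<ᵇ toℕ v) ∧ lookup S u ∧ lookup S v)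

record PlaneEmbedding {n : ℕ} (G : Graph n) : Set where
  field
    pos     : Fin n → Point
    pos-inj : ∀ u v → pos u ≡ pos v → u ≡ v
    -- arc u v is the drawing of the edge uv, used for u < v
    arc     : Fin n → Fin n → Polyline
    arc-start : ∀ u v → Adj G u v → toℕ u < toℕ v → Polyline.start (arc u v) ≡ pos u
    arc-end   : ∀ u v → Adj G u v → toℕ u < toℕ v → Polyline.end (arc u v) ≡ pos v
    arc-arc   : ∀ u v → Adj G u v → toℕ u < toℕ v → Polyline.IsArc (arc u v)
    arc-avoids-vertices : ∀ u v → Adj G u v → toℕ u < toℕ v →
      ∀ w → Polyline.On (arc u v) (pos w) → (w ≡ u ⊎ w ≡ v)
    arcs-disjoint : ∀ u v u' v' → Adj G u v → toℕ u < toℕ v →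
      Adj G u' v' → toℕ u' < toℕ v' → (u ≢ u' ⊎ v ≢ v') →
      ∀ q → Polyline.On (arc u v) q → Polyline.On (arc u' v') q →
      Σ (Fin n) λ w → q ≡ pos w

  InDrawing : Point → Set
  InDrawing q = (Σ (Fin n) λ w → q ≡ pos w) ⊎
    (Σ (Fin n) λ u → Σ (Fin n) λ v → Adj G u v × toℕ u < toℕ v × Polyline.On (arc u v) q)

  -- v is incident with the outer (unbounded) face: v can be joined by a
  -- polygonal curve, meeting the drawing only in v, to a point lying strictly
  -- to the right of the whole drawing
  OnOuterFace : Fin n → Set
  OnOuterFace v = Σ Polyline λ P →
    (Polyline.start P ≡ pos v) ×
    (∀ q → InDrawing q → proj₁ q ℚ.< proj₁ (Polyline.end P)) ×
    (∀ q → Polyline.On P q → InDrawing q → q ≡ pos v)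

PFun : Set
PFun = Fin 3 → Maybe (Fin 3)

-- C u v is C_{uv}; C_{vu} = C_{uv}^{-1} is imposed as a condition
Corr : ℕ → Set
Corr n = Fin n → Fin n → PFun

record IsCorrAssignment {n} (G : Graph n) (C : Corr n) : Set where
  field
    injective : ∀ u v → Adj G u v → ∀ a b c → C u v a ≡ just c → C u v b ≡ just c → a ≡ b
    inverse   : ∀ u v → Adj G u v → ∀ a c → C u v a ≡ just c → C v u c ≡ just a

ConsistentOnTriangles : ∀ {n} → Graph n → Corr n → Set
ConsistentOnTriangles G C = ∀ u v w → Adj G u v → Adj G v w → Adj G w u →
  ∀ c d → ((C u v c >>= C v w) >>= C w u) ≡ just d → d ≡ c

Full : PFun → Set
Full g = ∀ a → Σ (Fin 3) λ b → g a ≡ just b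

FullEdge : ∀ {n} → Corr n → Fin n → Fin n → Set
FullEdge C u v = Full (C u v) × Full (C v u)

domSize : PFun → ℕ
domSize g = sumFin λ a → ind (is-just (g a))

domSum : ∀ {n} → Graph n → Corr n → ℕ
domSum G C = sumFin λ u → sumFin λ v →
  if adjB G u v ∧ (toℕ u ℕ.<ᵇ toℕ v) then domSize (C u v) else 0

IsColoring : ∀ {n} → Graph n → Corr n → (Fin n → Fin 3) → Set
IsColoring G C f = ∀ u v → Adj G u v → C u v (f u) ≢ just (f v)

IsColoringOn : ∀ {n} → Graph n → Corr n → Subset n → (Fin n → Fin 3) → Set
IsColoringOn G C S f = ∀ u v → u ∈ S → v ∈ S → Adj G u v → C u v (f u) ≢ just (f v)

record Target : Set where
  field
    n   : ℕ
    G   : Graph n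
    emb : PlaneEmbedding G
    no-4-to-8-cycles : ∀ k → 4 ≤ k → k ≤ 8 → ¬ HasCycle G k
    S   : Subset n
    S-shape : (∣ S ∣ ≤ 1 × (∀ v → v ∈ S → PlaneEmbedding.OnOuterFace emb v)) ⊎
              (∀ v → (v ∈ S → PlaneEmbedding.OnOuterFace emb v) ×
                     (PlaneEmbedding.OnOuterFace emb v → v ∈ S))
    S-size : ∣ S ∣ ≤ 12
    C   : Corr n
    C-corr : IsCorrAssignment G C
    C-consistent : ConsistentOnTriangles G C
    f₀  : Fin n → Fin 3   -- only its values on S matter
    f₀-coloring : IsColoringOn G C S f₀

IsCounterexample : Target → Set
IsCounterexample B = ¬ (Σ (Fin n → Fin 3) λ f → IsColoring G C f × (∀ v → v ∈ S → f v ≡ f₀ v))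
  where open Target B

e : Target → ℕ
e B = numEdges G ℕ.∸ numEdgesIn G S
  where open Target B

s : Target → ℕ × ℕ × ℤ
s B = n , e B , ℤ.- (ℤ.+ domSum G C)
  where open Target B

_<ₗₑₓ_ : ℕ × ℕ × ℤ → ℕ × ℕ × ℤ → Set
_<ₗₑₓ_ = ×-Lex _≡_ _<_ (×-Lex _≡_ _<_ ℤ._<_)

IsMinimalCounterexample : Target → Set
IsMinimalCounterexample B =
  IsCounterexample B × (∀ B' → IsCounterexample B' → ¬ (s B' <ₗₑₓ s B))

module Submission where

-- By consistency of C on abc there are permutations P ⊇ C_ab, Q ⊇ C_bc of the
-- colours such that Q ∘ P agrees with C_ac on all colours that C_bc also hits.  Let C′
-- be C with the edges ab, bc, ac replaced by P, Q, Q ∘ P; this is a "relabelling" by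
-- id, P, Q ∘ P at a, b, c, and it stays consistent on triangles because without
-- 4-cycles no other triangle shares an edge with abc.  The target B′ with C′ is still
-- a counterexample: a C′-colouring can be recoloured at a and b (each has a single
-- neighbour outside the triangle, and there are three colours) into a C-colouring.
-- A non-full edge of abc would give B′ a larger total domain, so s(B′) < s(B).

open import Defs
open import Data.Nat using (ℕ)
open import Data.Fin.Subset using (_∉_)
open import Data.Product using (_×_)
open import Relation.Binary.PropositionalEquality using (_≡_)

import Data.Nat as ℕ
open import Data.Nat using (zero; suc; _≤_; _<_; z≤n)
open import Data.Nat.Properties
  using (≤-refl; <⇒≢; <⇒<ᵇ; <-cmp; m≤m+n; suc-injective; +-mono-≤; +-mono-<-≤; +-mono-≤-<)
import Data.Integer as ℤ
open import Data.Integer.Properties using (neg-mono-<)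
open import Data.Bool using (Bool; true; false; if_then_else_; _∧_)
open import Data.Bool.Properties using (T-≡)
import Data.Fin as Fin
open import Data.Fin using (Fin; toℕ; punchIn; punchOut)
open import Data.Fin.Patterns using (0F; 1F; 2F; 3F)
open import Data.Fin.Properties
  using (_≟_; any?; toℕ-injective; toℕ<n; punchInᵢ≢i; punchIn-punchOut; punchIn-injective)
open import Data.Fin.Permutation
  using (Permutation′; _⟨$⟩ʳ_; _⟨$⟩ˡ_; id; flip; _∘ₚ_; inverseˡ; inverseʳ; insert; insert-punchIn)
open import Data.Fin.Subset using (Subset; _∈_; ∣_∣; _-_; ⁅_⁆; inside; outside)
open import Data.Fin.Subset.Properties using (x∈p∧x≢y⇒x∈p-y; p─q⊆p; p─⊥≡p)
open import Data.Vec using (Vec; []; _∷_; lookup)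
open import Data.Vec.Base using (here; there)
open import Data.Vec.Properties using ([]=⇒lookup)
open import Data.Vec.Functional using (updateAt)
open import Data.Vec.Functional.Properties using (updateAt-updates; updateAt-minimal)
open import Data.Vec.Relation.Unary.All using ([]; _∷_)
open import Data.Vec.Relation.Unary.AllPairs using ([]; _∷_)
open import Data.Vec.Relation.Unary.Unique.Propositional using (Unique)
open import Data.Vec.Relation.Unary.Unique.Propositional.Properties using (lookup-injective)
open import Data.Maybe using (Maybe; just; nothing; _>>=_; _<∣>_; is-just)
open import Data.Maybe.Properties using (just-injective) renaming (≡-dec to ≡-decₘ)
open import Data.Product using (Σ; ∃; ∃₂; _,_; proj₁; proj₂)
open import Data.Sum using (_⊎_; inj₁; inj₂)
open import Data.Empty using (⊥; ⊥-elim)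
open import Function using (_∘_; Equivalence)
open import Relation.Nullary using (¬_; Dec; yes; no)
open import Relation.Nullary.Decidable using (dec-yes)
open import Relation.Unary using (Decidable)
open import Relation.Binary.Definitions using (tri<; tri≈; tri>)
open import Relation.Binary.PropositionalEquality
  using (_≢_; refl; sym; trans; cong; subst; ≢-sym; module ≡-Reasoning)

PartialInjective : ∀ {n} → (Fin n → Maybe (Fin n)) → Set
PartialInjective g = ∀ x x′ y → g x ≡ just y → g x′ ≡ just y → x ≡ x′

_Extends_ : ∀ {n} → Permutation′ n → (Fin n → Maybe (Fin n)) → Set
π Extends g = ∀ x y → g x ≡ just y → π ⟨$⟩ʳ x ≡ y

permutation-injective : ∀ {n} (π : Permutation′ n) {x y} → π ⟨$⟩ʳ x ≡ π ⟨$⟩ʳ y → x ≡ y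
permutation-injective π {x} {y} e =
  trans (sym (inverseˡ π)) (trans (cong (π ⟨$⟩ˡ_) e) (inverseˡ π))

defined? : ∀ {A : Set} (r : Maybe A) → Dec (∃ λ y → r ≡ just y)
defined? (just y) = yes (y , refl)
defined? nothing  = no λ ()

insert-here : ∀ {m} (x y : Fin (suc m)) (π : Permutation′ m) → insert x y π ⟨$⟩ʳ x ≡ y
insert-here x y π rewrite proj₂ (dec-yes (x ≟ x) refl) = refl

module _ {m : ℕ} (y : Fin (suc m)) where

  shrink : (r : Maybe (Fin (suc m))) → r ≢ just y → Maybe (Fin m)
  shrink nothing  _  = nothing
  shrink (just z) ne = just (punchOut (λ y≡z → ne (cong just (sym y≡z))))

  shrink-just : ∀ r ne {w} → shrink r ne ≡ just w → ∃ λ z → r ≡ just z × punchIn y w ≡ z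
  shrink-just (just z) ne refl = z , refl , punchIn-punchOut _

  shrink-of-just : ∀ r ne {z} → r ≡ just z → ∃ λ w → shrink r ne ≡ just w × punchIn y w ≡ z
  shrink-of-just (just z) ne refl = _ , refl , punchIn-punchOut _

-- Induction on n: pick a point x with g x = y, extend the restriction of g to the
-- remaining points and values, and insert x ↦ y.
extendToPermutation : ∀ {n} (g : Fin n → Maybe (Fin n)) → PartialInjective g →
                      ∃ λ π → π Extends g
extendToPermutation {zero}  g inj = id , λ ()
extendToPermutation {suc m} g inj with any? (λ x → defined? (g x))
... | no undefined     = id , λ x y gx → ⊥-elim (undefined (x , y , gx))
... | yes (x , y , gx) = insert x y π′ , extends
  where
  avoids : ∀ k → g (punchIn x k) ≢ just y
  avoids k e = punchInᵢ≢i x k (inj _ _ _ e gx)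

  g′ : Fin m → Maybe (Fin m)
  g′ k = shrink y (g (punchIn x k)) (avoids k)

  inj′ : PartialInjective g′
  inj′ k k′ w e e′ with shrink-just y _ (avoids k) e | shrink-just y _ (avoids k′) e′
  ... | z , gz , refl | .z , gz′ , refl = punchIn-injective x k k′ (inj _ _ z gz gz′)

  π′ : Permutation′ m
  π′ = proj₁ (extendToPermutation g′ inj′)

  π′-extends : π′ Extends g′
  π′-extends = proj₂ (extendToPermutation g′ inj′)

  extendsAt : ∀ w v → g w ≡ just v → Dec (x ≡ w) → insert x y π′ ⟨$⟩ʳ w ≡ v
  extendsAt w v gw (yes refl) = trans (insert-here x y π′) (just-injective (trans (sym gx) gw))
  extendsAt w v gw (no x≢w)
    with w′ , g′k≡w′ , w′↦v ← shrink-of-just y _ (avoids (punchOut x≢w))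
                                (subst (λ u → g u ≡ just v) (sym (punchIn-punchOut x≢w)) gw)
    = begin
      insert x y π′ ⟨$⟩ʳ w                       ≡⟨ cong (insert x y π′ ⟨$⟩ʳ_) (sym (punchIn-punchOut x≢w)) ⟩
      insert x y π′ ⟨$⟩ʳ punchIn x (punchOut x≢w) ≡⟨ insert-punchIn x y π′ (punchOut x≢w) ⟩
      punchIn y (π′ ⟨$⟩ʳ punchOut x≢w)           ≡⟨ cong (punchIn y) (π′-extends _ w′ g′k≡w′) ⟩
      punchIn y w′                               ≡⟨ w′↦v ⟩
      v                                          ∎
    where open ≡-Reasoning

  extends : insert x y π′ Extends g
  extends w v gw = extendsAt w v gw (x ≟ w)

-- A total partial injection of the colours is onto, so a partial inverse of it is
-- total as well.
full-inverse : ∀ {g h : PFun} → PartialInjective g → (∀ s t → g s ≡ just t → h t ≡ just s) →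
               Full g → Full h
full-inverse {g} {h} inj inv full t = π ⟨$⟩ˡ t , inv _ t g-hits-t
  where
  π : Permutation′ 3
  π = proj₁ (extendToPermutation g inj)
  g-hits-t : g (π ⟨$⟩ˡ t) ≡ just t
  g-hits-t with u , g≡u ← full (π ⟨$⟩ˡ t) =
    trans g≡u (cong just (trans (sym (proj₂ (extendToPermutation g inj) _ u g≡u)) (inverseʳ π)))

AtMostOne : ∀ {n} → (Fin n → Set) → Set
AtMostOne P = ∀ {s t} → P s → P t → s ≡ t

singleton-bound : ∀ {n} {P : Fin (suc n) → Set} → Decidable P → AtMostOne P →
                  ∃ λ u → ∀ t → P t → t ≡ u
singleton-bound P? unique with any? P?
... | yes (u , Pu) = u , λ t Pt → unique Pt Pu
... | no none      = 0F , λ t Pt → ⊥-elim (none (t , Pt))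

third-colour : (u v : Fin 3) → ∃ λ x → x ≢ u × x ≢ v
third-colour 0F 0F = 1F , (λ ()) , (λ ())
third-colour 0F 1F = 2F , (λ ()) , (λ ())
third-colour 0F 2F = 1F , (λ ()) , (λ ())
third-colour 1F 0F = 2F , (λ ()) , (λ ())
third-colour 1F 1F = 0F , (λ ()) , (λ ())
third-colour 1F 2F = 0F , (λ ()) , (λ ())
third-colour 2F 0F = 1F , (λ ()) , (λ ())
third-colour 2F 1F = 0F , (λ ()) , (λ ())
third-colour 2F 2F = 0F , (λ ()) , (λ ())

free-colour : {P Q : Fin 3 → Set} → Decidable P → Decidable Q → AtMostOne P → AtMostOne Q →
              ∃ λ x → ¬ P x × ¬ Q x
free-colour P? Q? uniqueP uniqueQ
  with u , P⊆u ← singleton-bound P? uniqueP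
     | v , Q⊆v ← singleton-bound Q? uniqueQ
  with x , x≢u , x≢v ← third-colour u v
  = x , (λ Px → x≢u (P⊆u x Px)) , (λ Qx → x≢v (Q⊆v x Qx))

hits? : (g : PFun) (z : Fin 3) → Decidable (λ t → g t ≡ just z)
hits? g z t = ≡-decₘ _≟_ (g t) (just z)

sumFin-mono : ∀ {n} {f g : Fin n → ℕ} → (∀ i → f i ≤ g i) → sumFin f ≤ sumFin g
sumFin-mono {zero}  f≤g = z≤n
sumFin-mono {suc n} f≤g = +-mono-≤ (f≤g 0F) (sumFin-mono (f≤g ∘ Fin.suc))

sumFin-mono-< : ∀ {n} {f g : Fin n → ℕ} → (∀ i → f i ≤ g i) → ∀ k → f k < g k →
                sumFin f < sumFin g
sumFin-mono-< f≤g 0F          fk<gk = +-mono-<-≤ fk<gk (sumFin-mono (f≤g ∘ Fin.suc))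
sumFin-mono-< f≤g (Fin.suc k) fk<gk = +-mono-≤-< (f≤g 0F) (sumFin-mono-< (f≤g ∘ Fin.suc) k fk<gk)

ind≤1 : ∀ b → ind b ≤ 1
ind≤1 true  = ≤-refl
ind≤1 false = z≤n

domSize≤3 : ∀ g → domSize g ≤ 3
domSize≤3 g = sumFin-mono (λ t → ind≤1 (is-just (g t)))

domSize-gap : ∀ {g : PFun} {x} → g x ≡ nothing → domSize g < 3
domSize-gap {g} {x} gx = sumFin-mono-< (λ t → ind≤1 (is-just (g t))) x gap
  where
  gap : ind (is-just (g x)) < 1
  gap rewrite gx = ≤-refl

full-without-gaps : ∀ (g : PFun) → (∀ x → g x ≡ nothing → ⊥) → Full g
full-without-gaps g no-gap x with g x in gx
... | just y  = y , refl
... | nothing = ⊥-elim (no-gap x gx)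

next : Fin 4 → Fin 4
next 0F = 1F
next 1F = 2F
next 2F = 3F
next 3F = 0F

cyclic-successor : ∀ (i j : Fin 4) → suc (toℕ i) ≡ toℕ j ⊎ (suc (toℕ i) ≡ 4 × toℕ j ≡ 0) →
                   j ≡ next i
cyclic-successor 0F j (inj₁ e)       = toℕ-injective (sym e)
cyclic-successor 1F j (inj₁ e)       = toℕ-injective (sym e)
cyclic-successor 2F j (inj₁ e)       = toℕ-injective (sym e)
cyclic-successor 3F j (inj₁ e)       = ⊥-elim (<⇒≢ (toℕ<n j) (sym e))
cyclic-successor 3F j (inj₂ (_ , e)) = toℕ-injective e
cyclic-successor 0F j (inj₂ (() , _))
cyclic-successor 1F j (inj₂ (() , _))
cyclic-successor 2F j (inj₂ (() , _))

module _ {n : ℕ} (G : Graph n) where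

  adj-sym : ∀ {u v} → Adj G u v → Adj G v u
  adj-sym {u} {v} = Graph.sym G u v

  adj⇒≢ : ∀ {u v} → Adj G u v → u ≢ v
  adj⇒≢ {u} {v} uv refl = Graph.irrefl G u uv

  four-cycle : ∀ {x y z w} → x ≢ y → x ≢ z → x ≢ w → y ≢ z → y ≢ w → z ≢ w →
               Adj G x y → Adj G y z → Adj G z w → Adj G w x → HasCycle G 4
  four-cycle {x} {y} {z} {w} x≢y x≢z x≢w y≢z y≢w z≢w xy yz zw wx =
    lookup vs , lookup-injective distinct , cycle-edge
    where
    vs : Vec (Fin n) 4
    vs = x ∷ y ∷ z ∷ w ∷ []
    distinct : Unique vs
    distinct = (x≢y ∷ x≢z ∷ x≢w ∷ []) ∷ (y≢z ∷ y≢w ∷ []) ∷ (z≢w ∷ []) ∷ [] ∷ []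
    edge : ∀ i → Adj G (lookup vs i) (lookup vs (next i))
    edge 0F = xy
    edge 1F = yz
    edge 2F = zw
    edge 3F = wx
    cycle-edge : ∀ i j → suc (toℕ i) ≡ toℕ j ⊎ (suc (toℕ i) ≡ 4 × toℕ j ≡ 0) →
                 Adj G (lookup vs i) (lookup vs j)
    cycle-edge i j step =
      subst (λ k → Adj G (lookup vs i) (lookup vs k)) (sym (cyclic-successor i j step)) (edge i)

  common-neighbour-unique : ¬ HasCycle G 4 → ∀ {x y z w} → Adj G x y →
    Adj G x z → Adj G y z → Adj G x w → Adj G y w → z ≡ w
  common-neighbour-unique no-4-cycle {x} {y} {z} {w} xy xz yz xw yw with z ≟ w
  ... | yes z≡w = z≡w
  ... | no  z≢w = ⊥-elim (no-4-cycle (four-cycle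
          (adj⇒≢ xz) (adj⇒≢ xy) (adj⇒≢ xw) (≢-sym (adj⇒≢ yz)) z≢w (adj⇒≢ yw)
          xz (adj-sym yz) yw (adj-sym xw)))

∣p∣≡1+∣p-x∣ : ∀ {n} {p : Subset n} {x : Fin n} → x ∈ p → ∣ p ∣ ≡ suc ∣ p - x ∣
∣p∣≡1+∣p-x∣ {p = inside  ∷ p} here        = cong (suc ∘ ∣_∣) (sym (p─⊥≡p p))
∣p∣≡1+∣p-x∣ {p = inside  ∷ p} (there x∈p) = cong suc (∣p∣≡1+∣p-x∣ x∈p)
∣p∣≡1+∣p-x∣ {p = outside ∷ p} (there x∈p) = ∣p∣≡1+∣p-x∣ x∈p

x∉p-x : ∀ {n} (p : Subset n) (x : Fin n) → x ∉ p - x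
x∉p-x (_ ∷ p) (Fin.suc x) (there x∈p-x) = x∉p-x p x x∈p-x

singleton : ∀ {n} {p : Subset n} → ∣ p ∣ ≡ 1 → ∃ λ x → x ∈ p × ∀ w → w ∈ p → w ≡ x
singleton {p = inside ∷ p} ∣p∣≡1 = 0F , here , only-zero
  where
  only-zero : ∀ w → w ∈ inside ∷ p → w ≡ 0F
  only-zero 0F          _           = refl
  only-zero (Fin.suc w) (there w∈p) with () ← trans (sym (suc-injective ∣p∣≡1)) (∣p∣≡1+∣p-x∣ w∈p)
singleton {p = outside ∷ p} ∣p∣≡1 with x , x∈p , only-x ← singleton ∣p∣≡1 =
  Fin.suc x , there x∈p , only-suc-x
  where
  only-suc-x : ∀ w → w ∈ outside ∷ p → w ≡ Fin.suc x
  only-suc-x (Fin.suc w) (there w∈p) = cong Fin.suc (only-x w w∈p)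

record OneMore {n} (p : Subset n) (b c : Fin n) : Set where
  field
    other      : Fin n
    other∈p    : other ∈ p
    other≢b    : other ≢ b
    other≢c    : other ≢ c
    only-other : ∀ w → w ∈ p → w ≢ b → w ≢ c → w ≡ other

third-member : ∀ {n} {p : Subset n} {b c} → ∣ p ∣ ≡ 3 → b ∈ p → c ∈ p → b ≢ c → OneMore p b c
third-member {p = p} {b} {c} ∣p∣≡3 b∈p c∈p b≢c = from-singleton (singleton ∣p-b-c∣≡1)
  where
  c∈p-b : c ∈ p - b
  c∈p-b = x∈p∧x≢y⇒x∈p-y c∈p (≢-sym b≢c)

  ∣p-b-c∣≡1 : ∣ p - b - c ∣ ≡ 1
  ∣p-b-c∣≡1 = sym (suc-injective (suc-injective
    (trans (sym ∣p∣≡3) (trans (∣p∣≡1+∣p-x∣ b∈p) (cong suc (∣p∣≡1+∣p-x∣ c∈p-b))))))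

  from-singleton : (∃ λ x → x ∈ p - b - c × ∀ w → w ∈ p - b - c → w ≡ x) → OneMore p b c
  from-singleton (x , x∈q , only-x) = record
    { other      = x
    ; other∈p    = p─q⊆p p ⁅ b ⁆ x∈p-b
    ; other≢b    = λ x≡b → x∉p-x p b (subst (_∈ p - b) x≡b x∈p-b)
    ; other≢c    = λ x≡c → x∉p-x (p - b) c (subst (_∈ p - b - c) x≡c x∈q)
    ; only-other = λ w w∈p w≢b w≢c → only-x w (x∈p∧x≢y⇒x∈p-y (x∈p∧x≢y⇒x∈p-y w∈p w≢b) w≢c)
    }
    where
    x∈p-b : x ∈ p - b
    x∈p-b = p─q⊆p (p - b) ⁅ c ⁆ x∈q

Relabelling : ℕ → Set
Relabelling n = Fin n → Maybe (Permutation′ 3)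

Relabelled : ∀ {n} → Relabelling n → Fin n → Set
Relabelled σ u = ∃ λ π → σ u ≡ just π

unrelabelled : ∀ {n} (σ : Relabelling n) {u} → σ u ≡ nothing → ¬ Relabelled σ u
unrelabelled σ σu≡nothing (π , σu≡π) with () ← trans (sym σu≡nothing) σu≡π

-- The full correspondence ρ ∘ π⁻¹ from a vertex relabelled by π to one relabelled by ρ.
between : Permutation′ 3 → Permutation′ 3 → Permutation′ 3
between π ρ = flip π ∘ₚ ρ

between-inverse : ∀ π ρ t → between ρ π ⟨$⟩ʳ (between π ρ ⟨$⟩ʳ t) ≡ t
between-inverse π ρ t = trans (cong (π ⟨$⟩ʳ_) (inverseˡ ρ)) (inverseʳ π)

between-cycle : ∀ π ρ τ t → between τ π ⟨$⟩ʳ (between ρ τ ⟨$⟩ʳ (between π ρ ⟨$⟩ʳ t)) ≡ t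
between-cycle π ρ τ t = begin
  π ⟨$⟩ʳ (τ ⟨$⟩ˡ (τ ⟨$⟩ʳ (ρ ⟨$⟩ˡ (ρ ⟨$⟩ʳ (π ⟨$⟩ˡ t))))) ≡⟨ cong (π ⟨$⟩ʳ_) (inverseˡ τ) ⟩
  π ⟨$⟩ʳ (ρ ⟨$⟩ˡ (ρ ⟨$⟩ʳ (π ⟨$⟩ˡ t)))                   ≡⟨ cong (π ⟨$⟩ʳ_) (inverseˡ ρ) ⟩
  π ⟨$⟩ʳ (π ⟨$⟩ˡ t)                                     ≡⟨ inverseʳ π ⟩
  t                                                     ∎
  where open ≡-Reasoning

relabelEdge : Maybe (Permutation′ 3) → Maybe (Permutation′ 3) → PFun → PFun
relabelEdge (just π) (just ρ) g = λ t → just (between π ρ ⟨$⟩ʳ t)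
relabelEdge _        _        g = g

relabel : ∀ {n} → Relabelling n → Corr n → Corr n
relabel σ C u v = relabelEdge (σ u) (σ v) (C u v)

TriangleClosed : ∀ {n} → Graph n → Relabelling n → Set
TriangleClosed G σ = ∀ u v w → Adj G u v → Adj G v w → Adj G w u →
  Relabelled σ u → Relabelled σ v → Relabelled σ w

module _ {n : ℕ} (G : Graph n) (σ : Relabelling n) (C : Corr n) where

  relabel-corr : IsCorrAssignment G C → IsCorrAssignment G (relabel σ C)
  relabel-corr corr = record { injective = injective′ ; inverse = inverse′ }
    where
    open IsCorrAssignment corr
    injective′ : ∀ u v → Adj G u v → PartialInjective (relabel σ C u v)
    injective′ u v uv with σ u | σ v
    ... | just π  | just ρ  = λ x x′ y e e′ →
                                permutation-injective (between π ρ) (just-injective (trans e (sym e′)))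
    ... | just _  | nothing = injective u v uv
    ... | nothing | _       = injective u v uv
    inverse′ : ∀ u v → Adj G u v → ∀ x y → relabel σ C u v x ≡ just y → relabel σ C v u y ≡ just x
    inverse′ u v uv x y with σ u | σ v
    ... | just π  | just ρ  = λ e → cong just (trans (cong (between ρ π ⟨$⟩ʳ_) (sym (just-injective e)))
                                                      (between-inverse π ρ x))
    ... | just _  | nothing = inverse u v uv x y
    ... | nothing | just _  = inverse u v uv x y
    ... | nothing | nothing = inverse u v uv x y

  -- Consistency survives: a triangle either lies in the relabelled part, where the
  -- composites cancel, or has at most one relabelled vertex and so keeps its edges.
  relabel-consistent : ConsistentOnTriangles G C → TriangleClosed G σ →
                       ConsistentOnTriangles G (relabel σ C)
  relabel-consistent consistent closed u v w uv vw wu c d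
    with σ u in σu | σ v in σv | σ w in σw
  ... | just π  | just ρ  | just τ  = λ e → trans (sym (just-injective e)) (between-cycle π ρ τ c)
  ... | just π  | just ρ  | nothing = ⊥-elim (unrelabelled σ σw (closed u v w uv vw wu (π , σu) (ρ , σv)))
  ... | just π  | nothing | just τ  = ⊥-elim (unrelabelled σ σv (closed w u v wu uv vw (τ , σw) (π , σu)))
  ... | nothing | just ρ  | just τ  = ⊥-elim (unrelabelled σ σu (closed v w u vw wu uv (ρ , σv) (τ , σw)))
  ... | just _  | nothing | nothing = consistent u v w uv vw wu c d
  ... | nothing | just _  | nothing = consistent u v w uv vw wu c d
  ... | nothing | nothing | just _  = consistent u v w uv vw wu c d
  ... | nothing | nothing | nothing = consistent u v w uv vw wu c d

module _ {n : ℕ} (σ : Relabelling n) (C : Corr n) where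

  relabel-domSize : ∀ u v → domSize (C u v) ≤ domSize (relabel σ C u v)
  relabel-domSize u v with σ u | σ v
  ... | just _  | just _  = domSize≤3 (C u v)
  ... | just _  | nothing = ≤-refl
  ... | nothing | _       = ≤-refl

  relabel-full : ∀ {u v π ρ} → σ u ≡ just π → σ v ≡ just ρ → domSize (relabel σ C u v) ≡ 3
  relabel-full σu σv rewrite σu | σv = refl

  relabel-both : ∀ {u v π ρ} → σ u ≡ just π → σ v ≡ just ρ → ∀ t →
                 relabel σ C u v t ≡ just (between π ρ ⟨$⟩ʳ t)
  relabel-both σu σv t rewrite σu | σv = refl

  relabel-away : ∀ {u v} → σ u ≡ nothing ⊎ σ v ≡ nothing → relabel σ C u v ≡ C u v
  relabel-away (inj₁ σu) rewrite σu = refl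
  relabel-away {u} (inj₂ σv) rewrite σv with σ u
  ... | just _  = refl
  ... | nothing = refl

counted-edge : ∀ {n} (G : Graph n) {u v} → Adj G u v → toℕ u < toℕ v →
               (adjB G u v ∧ (toℕ u ℕ.<ᵇ toℕ v)) ≡ true
counted-edge G {u} {v} uv u<v
  rewrite []=⇒lookup uv = Equivalence.to T-≡ (<⇒<ᵇ u<v)

if-mono : ∀ (β : Bool) {m k} → m ≤ k → (if β then m else 0) ≤ (if β then k else 0)
if-mono true  m≤k = m≤k
if-mono false _   = z≤n

domSum-increase : ∀ {n} (G : Graph n) {C C′ : Corr n} →
  (∀ u v → domSize (C u v) ≤ domSize (C′ u v)) →
  ∀ {u v} → Adj G u v → toℕ u < toℕ v → domSize (C u v) < domSize (C′ u v) →
  domSum G C < domSum G C′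
domSum-increase G {C} {C′} C≤C′ {u} {v} uv u<v strict =
  sumFin-mono-< (λ x → sumFin-mono (entry≤ x)) u (sumFin-mono-< (entry≤ u) v entry<)
  where
  entry≤ : ∀ x y → (if adjB G x y ∧ (toℕ x ℕ.<ᵇ toℕ y) then domSize (C x y) else 0)
                 ≤ (if adjB G x y ∧ (toℕ x ℕ.<ᵇ toℕ y) then domSize (C′ x y) else 0)
  entry≤ x y = if-mono (adjB G x y ∧ (toℕ x ℕ.<ᵇ toℕ y)) (C≤C′ x y)
  entry< : (if adjB G u v ∧ (toℕ u ℕ.<ᵇ toℕ v) then domSize (C u v) else 0)
         < (if adjB G u v ∧ (toℕ u ℕ.<ᵇ toℕ v) then domSize (C′ u v) else 0)
  entry< rewrite counted-edge G uv u<v = strict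

withAssignment : (B : Target) (C′ : Corr (Target.n B)) →
  IsCorrAssignment (Target.G B) C′ → ConsistentOnTriangles (Target.G B) C′ →
  IsColoringOn (Target.G B) C′ (Target.S B) (Target.f₀ B) → Target
withAssignment B C′ corr′ consistent′ f₀-colouring′ = record B
  { C = C′ ; C-corr = corr′ ; C-consistent = consistent′ ; f₀-coloring = f₀-colouring′ }

-- Changing only the assignment does not change |V| or e(B), so a counterexample with
-- larger total domain would have a smaller s(B).
no-larger-counterexample : ∀ B → IsMinimalCounterexample B →
  ∀ C′ corr′ consistent′ f₀-colouring′ →
  IsCounterexample (withAssignment B C′ corr′ consistent′ f₀-colouring′) →
  ¬ (domSum (Target.G B) (Target.C B) < domSum (Target.G B) C′)
no-larger-counterexample B (_ , minimal) C′ corr′ consistent′ f₀-colouring′ counterexample larger =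
  minimal (withAssignment B C′ corr′ consistent′ f₀-colouring′) counterexample (inj₂ (refl , inj₂ (refl , neg-mono-< (ℤ.+<+ larger))))

around : ∀ {n} (G : Graph n) (C : Corr n) → ConsistentOnTriangles G C →
  ∀ {u v w x y z x′} → Adj G u v → Adj G v w → Adj G w u →
  C u v x ≡ just y → C v w y ≡ just z → C w u z ≡ just x′ → x′ ≡ x
around G C consistent {u} {v} {w} {x} {y} {z} {x′} uv vw wu uvx vwy wuz =
  consistent u v w uv vw wu x x′ walk
  where
  walk : ((C u v x >>= C v w) >>= C w u) ≡ just x′
  walk rewrite uvx | vwy = wuz

module ConsistentTriangle {n} {G : Graph n} {C : Corr n}
  (corr : IsCorrAssignment G C) (consistent : ConsistentOnTriangles G C)
  {a b c : Fin n} (ab : Adj G a b) (bc : Adj G b c) (ca : Adj G c a) where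

  open IsCorrAssignment corr

  viaTriangle : PFun
  viaTriangle x = C a b x <∣> (C a c x >>= C c b)

  route : ∀ x y → (C a b x <∣> (C a c x >>= C c b)) ≡ just y →
          C a b x ≡ just y ⊎ ∃ λ z → C a c x ≡ just z × C c b z ≡ just y
  route x y e with C a b x | C a c x
  ... | just _  | _      = inj₁ e
  ... | nothing | just z = inj₂ (z , refl , e)

  -- Consistency on abc makes the two sources of viaTriangle compatible.
  viaTriangle-injective : PartialInjective viaTriangle
  viaTriangle-injective x x′ y e e′ with route x y e | route x′ y e′
  ... | inj₁ abx | inj₁ abx′ = injective a b ab x x′ y abx abx′
  ... | inj₁ abx | inj₂ (z , acx′ , cbz) =
    sym (around G C consistent ab bc ca abx (inverse c b (adj-sym G bc) z y cbz)
                                            (inverse a c (adj-sym G ca) x′ z acx′))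
  ... | inj₂ (z , acx , cbz) | inj₁ abx′ =
    around G C consistent ab bc ca abx′ (inverse c b (adj-sym G bc) z y cbz)
                                        (inverse a c (adj-sym G ca) x z acx)
  ... | inj₂ (z , acx , cbz) | inj₂ (z′ , acx′ , cbz′)
    with refl ← injective c b (adj-sym G bc) z z′ y cbz cbz′ =
    injective a c (adj-sym G ca) x x′ z acx acx′

  P : Permutation′ 3
  P = proj₁ (extendToPermutation viaTriangle viaTriangle-injective)

  P-extends-via : P Extends viaTriangle
  P-extends-via = proj₂ (extendToPermutation viaTriangle viaTriangle-injective)

  Q : Permutation′ 3
  Q = proj₁ (extendToPermutation (C b c) (injective b c bc))

  Q-extends-bc : Q Extends (C b c)
  Q-extends-bc = proj₂ (extendToPermutation (C b c) (injective b c bc))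

  P-extends-ab : P Extends (C a b)
  P-extends-ab x y abx = P-extends-via x y via
    where
    via : (C a b x <∣> (C a c x >>= C c b)) ≡ just y
    via rewrite abx = refl

  -- If C_ab x is defined, consistency along b → c → a → b gives P x = y; otherwise
  -- P x is given by the path a → c → b.
  QP-on-ac : ∀ x y z → C a c x ≡ just z → C b c y ≡ just z → Q ⟨$⟩ʳ (P ⟨$⟩ʳ x) ≡ z
  QP-on-ac x y z acx bcy = trans (cong (Q ⟨$⟩ʳ_) Px≡y) (Q-extends-bc y z bcy)
    where
    Px≡y : P ⟨$⟩ʳ x ≡ y
    Px≡y with C a b x in abx
    ... | just y′ = trans (P-extends-ab x y′ abx)
                          (around G C consistent bc ca ab bcy (inverse a c (adj-sym G ca) x z acx) abx)
    ... | nothing = P-extends-via x y via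
      where
      via : (C a b x <∣> (C a c x >>= C c b)) ≡ just y
      via rewrite abx | acx = inverse b c bc y z bcy

total : Permutation′ 3 → PFun
total π t = just (π ⟨$⟩ʳ t)

-- The colouring constraints for colours x, y of adjacent vertices a, b with common
-- neighbour c and further neighbours a′ of a, b′ of b, given the partial functions on
-- the five edges and the colours z, α, β of c, a′, b′.
record Admissible (ab ac bc aa′ bb′ : PFun) (z α β x y : Fin 3) : Set where
  field
    on-ab  : ab x ≢ just y
    on-ac  : ac x ≢ just z
    on-bc  : bc y ≢ just z
    on-aa′ : aa′ x ≢ just α
    on-bb′ : bb′ y ≢ just β

-- If ac x ≠ z the old colours already work; otherwise the choices of x′ and then y′
-- each avoid two colours, and bc y′ = z is excluded because q (p x) ≠ z.
recolour : ∀ (ab ac bc aa′ bb′ : PFun) (p q : Permutation′ 3) →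
  PartialInjective ab → PartialInjective ac → PartialInjective aa′ → PartialInjective bb′ →
  p Extends ab → q Extends bc →
  (∀ x y z → ac x ≡ just z → bc y ≡ just z → q ⟨$⟩ʳ (p ⟨$⟩ʳ x) ≡ z) →
  ∀ {z α β x y} → Admissible (total p) (total (p ∘ₚ q)) (total q) aa′ bb′ z α β x y →
  ∃₂ λ x′ y′ → Admissible ab ac bc aa′ bb′ z α β x′ y′
recolour ab ac bc aa′ bb′ p q inj-ab inj-ac inj-aa′ inj-bb′ p⊇ab q⊇bc qp-on-ac {z} {α} {β} {x} {y} new
  with hits? ac z x
... | no ac-x≢z = x , y , record
  { on-ab  = λ e → on-ab (cong just (p⊇ab x y e))
  ; on-ac  = ac-x≢z
  ; on-bc  = λ e → on-bc (cong just (q⊇bc y z e))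
  ; on-aa′ = on-aa′
  ; on-bb′ = on-bb′
  }
  where open Admissible new
... | yes ac-x≡z
  with x′ , ac-x′≢z , aa′-x′≢α ←
         free-colour (hits? ac z) (hits? aa′ α) (inj-ac _ _ z) (inj-aa′ _ _ α)
  with y′ , bb′-y′≢β , ab-x′≢y′ ←
         free-colour (hits? bb′ β) (λ t → ≡-decₘ _≟_ (ab x′) (just t)) (inj-bb′ _ _ β)
                     (λ e e′ → just-injective (trans (sym e) e′))
  = x′ , y′ , record
  { on-ab  = ab-x′≢y′
  ; on-ac  = ac-x′≢z
  ; on-bc  = λ e → Admissible.on-ac new (cong just (qp-on-ac x y′ z ac-x≡z e))
  ; on-aa′ = aa′-x′≢α
  ; on-bb′ = bb′-y′≢β
  }

module Triangle (B : Target) (minimal : IsMinimalCounterexample B) {a b c : Fin (Target.n B)}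
  (ab : Adj (Target.G B) a b) (bc : Adj (Target.G B) b c) (ca : Adj (Target.G B) c a)
  (deg-a : deg (Target.G B) a ≡ 3) (a∉S : a ∉ Target.S B)
  (deg-b : deg (Target.G B) b ≡ 3) (b∉S : b ∉ Target.S B) where

  open Target B
  open IsCorrAssignment C-corr
  open ConsistentTriangle C-corr C-consistent ab bc ca
    using (P; Q; P-extends-ab; Q-extends-bc; QP-on-ac)

  ba : Adj G b a
  ba = adj-sym G ab
  cb : Adj G c b
  cb = adj-sym G bc
  ac : Adj G a c
  ac = adj-sym G ca

  a≢b : a ≢ b
  a≢b = adj⇒≢ G ab
  b≢c : b ≢ c
  b≢c = adj⇒≢ G bc
  c≢a : c ≢ a
  c≢a = adj⇒≢ G ca

  InT : Fin n → Set
  InT u = u ≡ a ⊎ u ≡ b ⊎ u ≡ c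

  third-vertex : ∀ {u v} → InT u → InT v → u ≢ v → ∃ λ z → Adj G u z × Adj G v z × InT z
  third-vertex (inj₁ refl)         (inj₁ refl)         u≢v = ⊥-elim (u≢v refl)
  third-vertex (inj₁ refl)         (inj₂ (inj₁ refl))  _   = c , ac , bc , inj₂ (inj₂ refl)
  third-vertex (inj₁ refl)         (inj₂ (inj₂ refl))  _   = b , ab , cb , inj₂ (inj₁ refl)
  third-vertex (inj₂ (inj₁ refl))  (inj₁ refl)         _   = c , bc , ac , inj₂ (inj₂ refl)
  third-vertex (inj₂ (inj₁ refl))  (inj₂ (inj₁ refl))  u≢v = ⊥-elim (u≢v refl)
  third-vertex (inj₂ (inj₁ refl))  (inj₂ (inj₂ refl))  _   = a , ba , ca , inj₁ refl
  third-vertex (inj₂ (inj₂ refl))  (inj₁ refl)         _   = b , cb , ab , inj₂ (inj₁ refl)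
  third-vertex (inj₂ (inj₂ refl))  (inj₂ (inj₁ refl))  _   = a , ca , ba , inj₁ refl
  third-vertex (inj₂ (inj₂ refl))  (inj₂ (inj₂ refl))  u≢v = ⊥-elim (u≢v refl)

  no-4-cycle : ¬ HasCycle G 4
  no-4-cycle = no-4-to-8-cycles 4 ≤-refl (m≤m+n 4 4)

  -- Since G has no 4-cycle, no other triangle shares an edge with abc.
  common-neighbour-in-T : ∀ {u v w} → InT u → InT v → Adj G u v → Adj G v w → Adj G w u → InT w
  common-neighbour-in-T Tu Tv uv vw wu with z , uz , vz , Tz ← third-vertex Tu Tv (adj⇒≢ G uv) =
    subst InT (common-neighbour-unique G no-4-cycle uv uz vz (adj-sym G wu) vw) Tz

  -- a, b, c are relabelled by id, P and Q ∘ P, so that the new correspondences are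
  -- P on ab, Q on bc and Q ∘ P on ac.
  σ : Relabelling n
  σ = updateAt (updateAt (updateAt (λ _ → nothing) c (λ _ → just (P ∘ₚ Q))) b (λ _ → just P))
               a (λ _ → just id)

  σ-a : σ a ≡ just id
  σ-a = updateAt-updates a _

  σ-b : σ b ≡ just P
  σ-b = trans (updateAt-minimal b a _ (≢-sym a≢b)) (updateAt-updates b _)

  σ-c : σ c ≡ just (P ∘ₚ Q)
  σ-c = trans (updateAt-minimal c a _ c≢a)
              (trans (updateAt-minimal c b _ (≢-sym b≢c)) (updateAt-updates c _))

  σ-elsewhere : ∀ {u} → u ≢ a → u ≢ b → u ≢ c → σ u ≡ nothing
  σ-elsewhere u≢a u≢b u≢c = trans (updateAt-minimal _ a _ u≢a)
                              (trans (updateAt-minimal _ b _ u≢b) (updateAt-minimal _ c _ u≢c))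

  relabelled-in-T : ∀ {u} → Relabelled σ u → InT u
  relabelled-in-T {u} r with u ≟ a | u ≟ b | u ≟ c
  ... | yes u≡a | _       | _       = inj₁ u≡a
  ... | no _    | yes u≡b | _       = inj₂ (inj₁ u≡b)
  ... | no _    | no _    | yes u≡c = inj₂ (inj₂ u≡c)
  ... | no u≢a  | no u≢b  | no u≢c  = ⊥-elim (unrelabelled σ (σ-elsewhere u≢a u≢b u≢c) r)

  T-relabelled : ∀ {u} → InT u → Relabelled σ u
  T-relabelled (inj₁ refl)        = id , σ-a
  T-relabelled (inj₂ (inj₁ refl)) = P , σ-b
  T-relabelled (inj₂ (inj₂ refl)) = P ∘ₚ Q , σ-c

  σ-closed : TriangleClosed G σ
  σ-closed u v w uv vw wu ru rv =
    T-relabelled (common-neighbour-in-T (relabelled-in-T ru) (relabelled-in-T rv) uv vw wu)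

  C′ : Corr n
  C′ = relabel σ C

  C′-away : ∀ {u v} → Adj G u v → u ≢ a → u ≢ b → v ≢ a → v ≢ b → C′ u v ≡ C u v
  C′-away {u} {v} uv u≢a u≢b v≢a v≢b = relabel-away σ C (one-end-fixed (u ≟ c))
    where
    one-end-fixed : Dec (u ≡ c) → σ u ≡ nothing ⊎ σ v ≡ nothing
    one-end-fixed (yes refl) = inj₂ (σ-elsewhere v≢a v≢b (≢-sym (adj⇒≢ G uv)))
    one-end-fixed (no u≢c)   = inj₁ (σ-elsewhere u≢a u≢b u≢c)

  -- The precoloured vertices avoid a and b, so f₀ is still a C′-colouring of G[S].
  outside-S : ∀ {u} → u ∈ S → u ≢ a × u ≢ b
  outside-S u∈S = (λ { refl → a∉S u∈S }) , (λ { refl → b∉S u∈S })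

  f₀-colouring′ : IsColoringOn G C′ S f₀
  f₀-colouring′ u v u∈S v∈S uv =
    subst (λ h → h (f₀ u) ≢ just (f₀ v))
          (sym (C′-away uv (proj₁ (outside-S u∈S)) (proj₂ (outside-S u∈S))
                           (proj₁ (outside-S v∈S)) (proj₂ (outside-S v∈S))))
          (f₀-coloring u v u∈S v∈S uv)

  C′-corr : IsCorrAssignment G C′
  C′-corr = relabel-corr G σ C C-corr

  C′-consistent : ConsistentOnTriangles G C′
  C′-consistent = relabel-consistent G σ C C-consistent σ-closed

  B′ : Target
  B′ = withAssignment B C′ C′-corr C′-consistent f₀-colouring′

  open OneMore (third-member deg-a ab ac b≢c)
    renaming (other to a′; other∈p to aa′; other≢b to a′≢b; other≢c to a′≢c; only-other to only-a′)
  open OneMore (third-member deg-b ba bc (≢-sym c≢a))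
    renaming (other to b′; other∈p to bb′; other≢b to b′≢a; other≢c to b′≢c; only-other to only-b′)

  a′≢a : a′ ≢ a
  a′≢a = ≢-sym (adj⇒≢ G aa′)
  b′≢b : b′ ≢ b
  b′≢b = ≢-sym (adj⇒≢ G bb′)

  C′-ab : ∀ t → C′ a b t ≡ total P t
  C′-ab = relabel-both σ C σ-a σ-b

  C′-ac : ∀ t → C′ a c t ≡ total (P ∘ₚ Q) t
  C′-ac = relabel-both σ C σ-a σ-c

  C′-bc : ∀ t → C′ b c t ≡ total Q t
  C′-bc t = trans (relabel-both σ C σ-b σ-c t) (cong (total Q) (inverseʳ P))

  C′-aa′ : C′ a a′ ≡ C a a′
  C′-aa′ = relabel-away σ C (inj₂ (σ-elsewhere a′≢a a′≢b a′≢c))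

  C′-bb′ : C′ b b′ ≡ C b b′
  C′-bb′ = relabel-away σ C (inj₂ (σ-elsewhere b′≢a b′≢b b′≢c))

  admissible-for-C′ : ∀ f → IsColoring G C′ f →
    Admissible (total P) (total (P ∘ₚ Q)) (total Q) (C a a′) (C b b′) (f c) (f a′) (f b′) (f a) (f b)
  admissible-for-C′ f colouring′ = record
    { on-ab  = λ e → colouring′ a b ab (trans (C′-ab (f a)) e)
    ; on-ac  = λ e → colouring′ a c ac (trans (C′-ac (f a)) e)
    ; on-bc  = λ e → colouring′ b c bc (trans (C′-bc (f b)) e)
    ; on-aa′ = λ e → colouring′ a a′ aa′ (trans (cong (λ h → h (f a)) C′-aa′) e)
    ; on-bb′ = λ e → colouring′ b b′ bb′ (trans (cong (λ h → h (f b)) C′-bb′) e)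
    }

  recoloured : (Fin n → Fin 3) → Fin 3 → Fin 3 → Fin n → Fin 3
  recoloured f x y = updateAt (updateAt f b (λ _ → y)) a (λ _ → x)

  module _ (f : Fin n → Fin 3) (x y : Fin 3) where

    recoloured-a : recoloured f x y a ≡ x
    recoloured-a = updateAt-updates a _

    recoloured-b : recoloured f x y b ≡ y
    recoloured-b = trans (updateAt-minimal b a _ (≢-sym a≢b)) (updateAt-updates b _)

    recoloured-elsewhere : ∀ {u} → u ≢ a → u ≢ b → recoloured f x y u ≡ f u
    recoloured-elsewhere u≢a u≢b = trans (updateAt-minimal _ a _ u≢a) (updateAt-minimal _ b _ u≢b)

  -- A C′-colouring, recoloured at a and b by colours admissible for C, is a C-colouring:
  -- the edges at a and b are covered by admissibility (a and b have degree three), all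
  -- other edges keep their correspondence.
  module Recoloured (f : Fin n → Fin 3) (colouring′ : IsColoring G C′ f) {x y : Fin 3}
    (admissible : Admissible (C a b) (C a c) (C b c) (C a a′) (C b b′) (f c) (f a′) (f b′) x y) where

    open Admissible admissible

    g : Fin n → Fin 3
    g = recoloured f x y

    g-c : g c ≡ f c
    g-c = recoloured-elsewhere f x y c≢a (≢-sym b≢c)

    at-a : ∀ v → Adj G a v → C a v x ≢ just (g v)
    at-a v av = check (v ≟ b) (v ≟ c)
      where
      check : Dec (v ≡ b) → Dec (v ≡ c) → C a v x ≢ just (g v)
      check (yes refl) _          rewrite recoloured-b f x y = on-ab
      check (no v≢b)   (yes refl) rewrite g-c = on-ac
      check (no v≢b)   (no v≢c)   rewrite only-a′ v av v≢b v≢c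
                                        | recoloured-elsewhere f x y a′≢a a′≢b = on-aa′

    at-b : ∀ v → Adj G b v → C b v y ≢ just (g v)
    at-b v bv = check (v ≟ a) (v ≟ c)
      where
      check : Dec (v ≡ a) → Dec (v ≡ c) → C b v y ≢ just (g v)
      check (yes refl) _          rewrite recoloured-a f x y = λ e → on-ab (inverse b a ba y x e)
      check (no v≢a)   (yes refl) rewrite g-c = on-bc
      check (no v≢a)   (no v≢c)   rewrite only-b′ v bv v≢a v≢c
                                        | recoloured-elsewhere f x y b′≢a b′≢b = on-bb′

    away : ∀ {u v} → Adj G u v → u ≢ a → u ≢ b → v ≢ a → v ≢ b → C u v (g u) ≢ just (g v)
    away {u} {v} uv u≢a u≢b v≢a v≢b
      rewrite recoloured-elsewhere f x y u≢a u≢b | recoloured-elsewhere f x y v≢a v≢b =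
      subst (λ h → h (f u) ≢ just (f v)) (C′-away uv u≢a u≢b v≢a v≢b) (colouring′ u v uv)

    reversed : ∀ {u v} → Adj G u v → C v u (g v) ≢ just (g u) → C u v (g u) ≢ just (g v)
    reversed {u} {v} uv ne e = ne (inverse u v uv (g u) (g v) e)

    colouring : IsColoring G C g
    colouring u v uv = by-ends (u ≟ a) (u ≟ b) (v ≟ a) (v ≟ b)
      where
      by-ends : Dec (u ≡ a) → Dec (u ≡ b) → Dec (v ≡ a) → Dec (v ≡ b) → C u v (g u) ≢ just (g v)
      by-ends (yes refl) _          _          _          rewrite recoloured-a f x y = at-a v uv
      by-ends (no _)     (yes refl) _          _          rewrite recoloured-b f x y = at-b v uv
      by-ends (no _)     (no _)     (yes refl) _          =
        reversed uv (subst (λ s → C a u s ≢ just (g u)) (sym (recoloured-a f x y)) (at-a u (adj-sym G uv)))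
      by-ends (no _)     (no _)     (no _)     (yes refl) =
        reversed uv (subst (λ s → C b u s ≢ just (g u)) (sym (recoloured-b f x y)) (at-b u (adj-sym G uv)))
      by-ends (no u≢a)   (no u≢b)   (no v≢a)   (no v≢b)   = away uv u≢a u≢b v≢a v≢b

  recolourable : ∀ f → IsColoring G C′ f → (∀ v → v ∈ S → f v ≡ f₀ v) →
                 Σ (Fin n → Fin 3) λ g → IsColoring G C g × (∀ v → v ∈ S → g v ≡ f₀ v)
  recolourable f colouring′ extends
    with x , y , admissible ← recolour (C a b) (C a c) (C b c) (C a a′) (C b b′) P Q
           (injective a b ab) (injective a c ac) (injective a a′ aa′) (injective b b′ bb′)
           P-extends-ab Q-extends-bc QP-on-ac (admissible-for-C′ f colouring′)
    = recoloured f x y , Recoloured.colouring f colouring′ admissible , extends′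
    where
    extends′ : ∀ v → v ∈ S → recoloured f x y v ≡ f₀ v
    extends′ v v∈S = trans (recoloured-elsewhere f x y (proj₁ (outside-S v∈S)) (proj₂ (outside-S v∈S)))
                           (extends v v∈S)

  B′-counterexample : IsCounterexample B′
  B′-counterexample (f , colouring′ , extends) = proj₁ minimal (recolourable f colouring′ extends)

  -- An edge between relabelled vertices, oriented as counted in domSum, is full: a gap
  -- would make domSum for C′ larger, against the minimality of B.
  counted-full : ∀ {u v π ρ} → σ u ≡ just π → σ v ≡ just ρ → Adj G u v → toℕ u < toℕ v →
                 Full (C u v)
  counted-full {u} {v} σu σv uv u<v = full-without-gaps (C u v) λ x gap →
    no-larger-counterexample B minimal C′ C′-corr C′-consistent f₀-colouring′ B′-counterexample
      (domSum-increase G {C} {C′} (relabel-domSize σ C) uv u<v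
        (subst (domSize (C u v) <_) (sym (relabel-full σ C σu σv)) (domSize-gap {C u v} gap)))

  edge-full : ∀ {u v π ρ} → σ u ≡ just π → σ v ≡ just ρ → Adj G u v → FullEdge C u v
  edge-full {u} {v} σu σv uv with <-cmp (toℕ u) (toℕ v)
  ... | tri< u<v _ _ = forward , full-inverse (injective u v uv) (inverse u v uv) forward
    where forward = counted-full σu σv uv u<v
  ... | tri≈ _ u≡v _ = ⊥-elim (adj⇒≢ G uv (toℕ-injective u≡v))
  ... | tri> _ _ v<u = full-inverse (injective v u vu) (inverse v u vu) backward , backward
    where vu = adj-sym G uv
          backward = counted-full σv σu vu v<u

  all-edges-full : FullEdge C a b × FullEdge C b c × FullEdge C c a
  all-edges-full = edge-full σ-a σ-b ab , edge-full σ-b σ-c bc , edge-full σ-c σ-a ca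

lemma8 : (B : Target) → IsMinimalCounterexample B →
    ∀ a b c → Adj (Target.G B) a b → Adj (Target.G B) b c → Adj (Target.G B) c a →
    deg (Target.G B) a ≡ 3 → a ∉ Target.S B →
    deg (Target.G B) b ≡ 3 → b ∉ Target.S B →
    FullEdge (Target.C B) a b × FullEdge (Target.C B) b c × FullEdge (Target.C B) c a
lemma8 B minimal a b c ab bc ca deg-a a∉S deg-b b∉S =
  Triangle.all-edges-full B minimal ab bc ca deg-a a∉S deg-b b∉S
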